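{- Let $q\ge0$, let $D\subseteq E(\vec{\triangle}_q)$ be a set of arcs of the directed $q$-triangle fractal $\vec{\triangle}_q$, and let $x\in V(\vec{\triangle}_q)$. If $x$ is reachable from $\sigma$ in $\vec{\triangle}_q-D$, then $\mathrm{dist}_{\vec{\triangle}_q-D}(\sigma,x)\le q+|D|+1$.
   Context: The undirected $q$-triangle fractal $\triangle_q$ is built as follows: start with two vertices $\sigma,\tau$ joined by one edge, which is marked. Then repeat $q$ times: for every currently marked edge $\{a,b\}$ add a new vertex $w$ and the two new edges $\{a,w\},\{w,b\}$, mark these new edges, and unmark all previously marked edges. The boundary $B_0=\{\{\sigma,\tau\}\}$ and, for $i\ge1$, $B_i$ is the set of edges added in the $i$-th repetition; each $B_i$ forms a $\sigma$-$\tau$ path and these paths are pairwise edge-disjoint and cover all edges. The directed fractal $\vec{\triangle}_q$ is obtained by orienting the edges of each boundary $B_i$ so that $B_i$ becomes a directed path from $\sigma$ to $\tau$. Distances are lengths (numbers of arcs) of shortest directed paths. -}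

module Defs where

open import Data.Nat using (ℕ; zero; suc; _+_; _*_; _∸_; _^_; _≤_; _<_)
open import Data.Product using (_×_; _,_; ∃-syntax)
open import Data.List using (List)
open import Data.List.Membership.Propositional using (_∉_)

-- Vertices are the dyadic positions 0 … 2^q (vertex k sits at k/2^q):
--   σ = 0, τ = 2^q, and the vertices added in repetition i ≥ 1 are the
--   odd multiples of 2^(q-i).
-- The boundary B_i (0 ≤ i ≤ q) is the path σ → … → τ through the
-- multiples of 2^(q-i); its j-th arc (j < 2^i) goes from j·2^(q-i)
-- to (j+1)·2^(q-i).  An arc is named by the pair (i , j).

Arc : Set
Arc = ℕ × ℕ

IsArc : ℕ → Arc → Set
IsArc q (i , j) = (i ≤ q) × (j < 2 ^ i)

tail : ℕ → Arc → ℕ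
tail q (i , j) = j * 2 ^ (q ∸ i)

head : ℕ → Arc → ℕ
head q (i , j) = suc j * 2 ^ (q ∸ i)

IsVertex : ℕ → ℕ → Set
IsVertex q x = x ≤ 2 ^ q

σ : ℕ
σ = 0

τ : ℕ → ℕ
τ q = 2 ^ q

data Walk (q : ℕ) (D : List Arc) : ℕ → ℕ → ℕ → Set where
  []   : ∀ {u} → Walk q D u u 0
  step : ∀ {v n} (a : Arc) → IsArc q a → a ∉ D →
         Walk q D (head q a) v n → Walk q D (tail q a) v (suc n)

Reachable : ℕ → List Arc → ℕ → ℕ → Set
Reachable q D u x = ∃[ n ] Walk q D u x n

DistLe : ℕ → List Arc → ℕ → ℕ → ℕ → Set
DistLe q D u x b = ∃[ n ] ((n ≤ b) × Walk q D u x n)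

module Submission where

-- In the model of Defs, vertices are the positions 0 … 2^q and the arc
-- (i , j) runs from j·2^(q-i) to (j+1)·2^(q-i), so walks strictly ascend.
-- Call [a , b] a dyadic interval of level n ≤ q if a = k·2^n and
-- b = a + 2^n with k < 2^(q-n); it is spanned by the arc (q-n , k).
-- Dyadic intervals are laminar: an arc that starts in the left half of
-- [a , b] and jumps over its midpoint m starts at a and ends at or beyond b.
-- Hence a walk from a to a vertex x ∈ [m , b] either visits m, or is a
-- single arc.  Writing c(a , b) for the number of arcs of D inside [a , b],
-- induction on the level n gives, for a dyadic interval [a , b]:
--   (A) if b is reachable from a then dist(a , b) ≤ c(a , b) + 1
--       (use the spanning arc if it survives, else split at m: the spanning
--        arc lies in D but in neither half, so c(a,m) + c(m,b) < c(a,b));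
--   (B) every x ∈ [a , b] reachable from a has dist(a , x) ≤ n + c(a , b) + 1
--       (stay in the left half, or go a → m by (A) and m → x by (B)).
-- The theorem is (B) for the interval [0 , 2^q] of level q.

open import Defs
open import Data.Nat using (ℕ; zero; suc; _+_; _*_; _∸_; _^_; _≤_; _<_; z≤n; s≤s; _≤?_)
open import Data.Nat.Properties
open import Data.Nat.Divisibility using (_∣_; divides; ∣-trans; ∣m∣n⇒∣m+n; n∣m*n)
open import Data.Nat.Tactic.RingSolver using (solve-∀)
open import Data.Product using (_×_; _,_; proj₁; proj₂)
open import Data.Product.Properties using (≡-dec)
open import Data.Sum using (_⊎_; inj₁; inj₂)
open import Data.List using (List; []; _∷_; length; filter)
open import Data.List.Properties using (length-filter)
open import Data.List.Relation.Unary.All using (All)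
open import Data.List.Relation.Unary.Unique.Propositional using (Unique)
open import Data.List.Relation.Unary.Any using (here; there)
open import Data.List.Membership.Propositional using (_∈_; _∉_)
open import Data.List.Membership.DecPropositional (≡-dec _≟_ _≟_) using (_∈?_)
open import Data.Empty using (⊥; ⊥-elim)
open import Level using (0ℓ)
open import Relation.Nullary using (yes; no; ¬_)
open import Relation.Nullary.Decidable using (_×-dec_)
open import Relation.Unary using (Pred; Decidable; _⊆_)
open import Relation.Binary.PropositionalEquality

pow-pos : ∀ n → 0 < 2 ^ n
pow-pos n = m^n>0 2 n

pow-grows : ∀ n → 2 ^ n < 2 ^ suc n
pow-grows n = ^-monoʳ-< 2 (s≤s (s≤s z≤n)) (n<1+n n)

pow-dvd : ∀ {h n} → h ≤ n → 2 ^ h ∣ 2 ^ n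
pow-dvd {h} {n} h≤n = divides (2 ^ (n ∸ h)) (begin
  2 ^ n              ≡⟨ cong (2 ^_) (sym (m∸n+n≡m h≤n)) ⟩
  2 ^ (n ∸ h + h)    ≡⟨ ^-distribˡ-+-* 2 (n ∸ h) h ⟩
  2 ^ (n ∸ h) * 2 ^ h ∎)
  where open ≡-Reasoning

multiples-apart : ∀ {p t m} → p ∣ t → p ∣ m → t < m → t + p ≤ m
multiples-apart {p} (divides x refl) (divides y refl) t<m =
  subst (_≤ y * p) (+-comm p (x * p)) (*-monoˡ-≤ p (*-cancelʳ-< p x y t<m))

laminar : ∀ h j n c → let a = c * 2 ^ suc n ; t = j * 2 ^ h in
          a ≤ t → t < a + 2 ^ n → a + 2 ^ n < suc j * 2 ^ h →
          (t ≡ a) × (a + 2 ^ suc n ≤ suc j * 2 ^ h)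
-- If the arc is short (h ≤ n), 2^h divides m, so the arc cannot straddle m.
-- If it is long, 2^(n+1) divides t, which pins t to the multiple a.
laminar h j n c a≤t t<m m<hd with h ≤? n
... | yes h≤n = ⊥-elim (<⇒≱ m<hd (subst (_≤ m) (+-comm t (2 ^ h)) t+2^h≤m))
  where
  a = c * 2 ^ suc n
  t = j * 2 ^ h
  m = a + 2 ^ n
  2^h∣m : 2 ^ h ∣ m
  2^h∣m = ∣m∣n⇒∣m+n (∣-trans (pow-dvd (m≤n⇒m≤1+n h≤n)) (n∣m*n c)) (pow-dvd h≤n)
  t+2^h≤m : t + 2 ^ h ≤ m
  t+2^h≤m = multiples-apart (n∣m*n j) 2^h∣m t<m
... | no h≰n with m≤n⇒m<n∨m≡n a≤t
...   | inj₁ a<t = ⊥-elim (<⇒≱ (<-trans t<m m<a+2^sn) a+2^sn≤t)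
  where
  a = c * 2 ^ suc n
  a+2^sn≤t : a + 2 ^ suc n ≤ j * 2 ^ h
  a+2^sn≤t = multiples-apart (n∣m*n c) (∣-trans (pow-dvd (≰⇒> h≰n)) (n∣m*n j)) a<t
  m<a+2^sn : a + 2 ^ n < a + 2 ^ suc n
  m<a+2^sn = +-monoʳ-< a (pow-grows n)
...   | inj₂ a≡t = sym a≡t , (begin
    a + 2 ^ suc n  ≤⟨ +-monoʳ-≤ a (^-monoʳ-≤ 2 (≰⇒> h≰n)) ⟩
    a + 2 ^ h      ≡⟨ cong (_+ 2 ^ h) a≡t ⟩
    t + 2 ^ h      ≡⟨ +-comm t (2 ^ h) ⟩
    suc j * 2 ^ h  ∎)
  where
  open ≤-Reasoning
  a = c * 2 ^ suc n
  t = j * 2 ^ h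

count : {A : Set} {P : Pred A 0ℓ} → Decidable P → List A → ℕ
count P? xs = length (filter P? xs)

module DisjointCount {A : Set} {P Q R : Pred A 0ℓ}
                     (P? : Decidable P) (Q? : Decidable Q) (R? : Decidable R)
                     (disjoint : ∀ {e} → P e → Q e → ⊥) (P⊆R : P ⊆ R) (Q⊆R : Q ⊆ R) where

  both-grow : ∀ {s x x′ y} → x′ ≡ suc x → s + x ≤ y → s + x′ ≤ suc y
  both-grow {s} {x} {y = y} refl le = subst (_≤ suc y) (sym (+-suc s x)) (s≤s le)

  count-cons : ∀ {s} e xs → s + (count P? xs + count Q? xs) ≤ count R? xs →
               s + (count P? (e ∷ xs) + count Q? (e ∷ xs)) ≤ count R? (e ∷ xs)
  count-cons {s} e xs ih with P? e | Q? e | R? e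
  ... | yes p | yes q | _     = ⊥-elim (disjoint p q)
  ... | yes _ | no _  | yes _ = both-grow {s} refl ih
  ... | yes p | no _  | no ¬r = ⊥-elim (¬r (P⊆R p))
  ... | no _  | yes _ | yes _ = both-grow {s} (+-suc (count P? xs) (count Q? xs)) ih
  ... | no _  | yes q | no ¬r = ⊥-elim (¬r (Q⊆R q))
  ... | no _  | no _  | yes _ = m≤n⇒m≤1+n ih
  ... | no _  | no _  | no _  = ih

  -- s = 0 gives the inequality, s = 1 its strict form
  count-disjoint : ∀ xs → count P? xs + count Q? xs ≤ count R? xs
  count-disjoint []       = z≤n
  count-disjoint (e ∷ xs) = count-cons {0} e xs (count-disjoint xs)

  count-disjoint-strict : ∀ {e₀} → R e₀ → ¬ P e₀ → ¬ Q e₀ →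
                          ∀ {xs} → e₀ ∈ xs → count P? xs + count Q? xs < count R? xs
  count-disjoint-strict {e₀} r ¬p ¬q {_ ∷ xs} (here refl) with P? e₀ | Q? e₀ | R? e₀
  ... | yes p | _     | _     = ⊥-elim (¬p p)
  ... | no _  | yes q | _     = ⊥-elim (¬q q)
  ... | no _  | no _  | yes _ = s≤s (count-disjoint xs)
  ... | no _  | no _  | no ¬r = ⊥-elim (¬r r)
  count-disjoint-strict r ¬p ¬q {e ∷ xs} (there e₀∈xs) =
    count-cons {1} e xs (count-disjoint-strict r ¬p ¬q e₀∈xs)

dbl-left : ∀ k p → k * (2 * p) ≡ (2 * k) * p
dbl-left = solve-∀

dbl-mid : ∀ k p → k * (2 * p) + p ≡ suc (2 * k) * p
dbl-mid = solve-∀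

dbl-right : ∀ a p → a + 2 * p ≡ (a + p) + p
dbl-right = solve-∀

-- the count bookkeeping of (B) below: a walk a → m → x adds the bounds
regroup : ∀ n cL cR → suc cL + (n + cR + 1) ≡ suc n + (cL + cR) + 1
regroup = solve-∀

no-room : ∀ {m n k} → m + n ≤ k → k ≤ m → n ≡ 0
no-room {m} {n} m+n≤k k≤m =
  n≤0⇒n≡0 (+-cancelˡ-≤ m n 0 (≤-trans m+n≤k (≤-trans k≤m (≤-reflexive (sym (+-identityʳ m))))))

module DyadicIntervals (q : ℕ) where

  -- [a , b] is the dyadic interval of level n with index k; the index
  -- bound says that it is spanned by the arc (q ∸ n , k) of the fractal
  record Dyadic (n a b : ℕ) : Set where
    constructor dyadic
    field
      index : ℕ
      level : n ≤ q
      bound : index < 2 ^ (q ∸ n)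
      left  : a ≡ index * 2 ^ n
      width : b ≡ a + 2 ^ n

  whole : Dyadic q 0 (2 ^ q)
  whole = dyadic 0 ≤-refl (subst (λ z → 0 < 2 ^ z) (sym (n∸n≡0 q)) (s≤s z≤n)) refl refl

  spanning : ∀ {n a b} → Dyadic n a b → Arc
  spanning {n} d = (q ∸ n , Dyadic.index d)

  spanning-arc : ∀ {n a b} (d : Dyadic n a b) →
                 IsArc q (spanning d) × (tail q (spanning d) ≡ a) × (head q (spanning d) ≡ b)
  spanning-arc {n} {a} {b} (dyadic k n≤q k< a≡ b≡) = (m∸n≤m q n , k<) , tail≡a , head≡b
    where
    open ≡-Reasoning
    level≡ : q ∸ (q ∸ n) ≡ n
    level≡ = m∸[m∸n]≡n n≤q
    tail≡a : k * 2 ^ (q ∸ (q ∸ n)) ≡ a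
    tail≡a = trans (cong (λ h → k * 2 ^ h) level≡) (sym a≡)
    head≡b : suc k * 2 ^ (q ∸ (q ∸ n)) ≡ b
    head≡b = begin
      2 ^ (q ∸ (q ∸ n)) + k * 2 ^ (q ∸ (q ∸ n)) ≡⟨ cong₂ _+_ (cong (2 ^_) level≡) tail≡a ⟩
      2 ^ n + a                                 ≡⟨ +-comm (2 ^ n) a ⟩
      a + 2 ^ n                                 ≡⟨ sym b≡ ⟩
      b                                         ∎

  midpoint-inside : ∀ {n a b} → Dyadic (suc n) a b → (a < a + 2 ^ n) × (a + 2 ^ n < b)
  midpoint-inside {n} {a} (dyadic _ _ _ _ refl) =
    m<m+n a (pow-pos n) , +-monoʳ-< a (pow-grows n)

  halves : ∀ {n a b} → Dyadic (suc n) a b →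
           Dyadic n a (a + 2 ^ n) × Dyadic n (a + 2 ^ n) b
  halves {n} {a} {b} (dyadic k sn≤q k< a≡ b≡) =
    dyadic (2 * k) n≤q (≤-trans (n≤1+n _) 2k+1<) (trans a≡ (dbl-left k (2 ^ n))) refl ,
    dyadic (suc (2 * k)) n≤q 2k+1< (trans (cong (_+ 2 ^ n) a≡) (dbl-mid k (2 ^ n)))
           (trans b≡ (dbl-right a (2 ^ n)))
    where
    n≤q : n ≤ q
    n≤q = ≤-trans (n≤1+n n) sn≤q
    2k+1< : suc (2 * k) < 2 ^ (q ∸ n)
    2k+1< = subst₂ _≤_ (*-suc 2 k) (cong (2 ^_) (sym (+-∸-assoc 1 sn≤q))) (*-monoʳ-≤ 2 k<)

module Walks (q : ℕ) (D : List Arc) where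
  open DyadicIntervals q

  tail<head : ∀ e → tail q e < head q e
  tail<head (i , j) = +-monoˡ-≤ (j * 2 ^ (q ∸ i)) (pow-pos (q ∸ i))

  walk-ascends : ∀ {u v l} → Walk q D u v l → u + l ≤ v
  walk-ascends {u} [] = ≤-reflexive (+-identityʳ u)
  walk-ascends {l = suc l} (step (i , j) _ _ w) =
    ≤-trans (≤-reflexive (+-suc (j * 2 ^ (q ∸ i)) l))
            (≤-trans (+-monoˡ-≤ l (tail<head (i , j))) (walk-ascends w))

  _++ʷ_ : ∀ {u v w m n} → Walk q D u v m → Walk q D v w n → Walk q D u w (m + n)
  []             ++ʷ w′ = w′
  step e a e∉ w ++ʷ w′ = step e a e∉ (w ++ʷ w′)

  walk-dist : ∀ {u x l b} → Walk q D u x l → l ≤ b → DistLe q D u x b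
  walk-dist {l = l} w l≤b = l , l≤b , w

  dist-weaken : ∀ {u x b b′} → b ≤ b′ → DistLe q D u x b → DistLe q D u x b′
  dist-weaken b≤b′ (l , l≤b , w) = l , ≤-trans l≤b b≤b′ , w

  dist-concat : ∀ {u m x b b′} → DistLe q D u m b → DistLe q D m x b′ →
                DistLe q D u x (b + b′)
  dist-concat (l , l≤b , w) (l′ , l′≤b′ , w′) = l + l′ , +-mono-≤ l≤b l′≤b′ , w ++ʷ w′

  record Jump (u x m l : ℕ) : Set where
    field
      arc          : Arc
      before after : ℕ
      below        : tail q arc < m
      above        : m < head q arc
      reach-tail   : u + before ≤ tail q arc
      leave-head   : head q arc + after ≤ x
      split-length : l ≡ before + suc after

  visit-or-jump : ∀ {u x l} m → u ≤ m → m ≤ x → Walk q D u x l →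
                  (Reachable q D u m × Reachable q D m x) ⊎ Jump u x m l
  visit-or-jump {u} m u≤m m≤x w with m ≤? u
  ... | yes m≤u with refl ← ≤-antisym u≤m m≤u = inj₁ ((0 , []) , (_ , w))
  visit-or-jump m u≤m m≤x [] | no m≰u = ⊥-elim (m≰u m≤x)
  visit-or-jump m u≤m m≤x (step e e-arc e∉D w) | no m≰u with head q e ≤? m
  ... | no hd≰m = inj₂ (record
    { arc = e ; before = 0 ; after = _ ; below = ≰⇒> m≰u ; above = ≰⇒> hd≰m
    ; reach-tail = ≤-reflexive (+-identityʳ _) ; leave-head = walk-ascends w
    ; split-length = refl })
  ... | yes hd≤m with visit-or-jump m hd≤m m≤x w
  ...   | inj₁ ((l₁ , w₁) , r₂) = inj₁ ((suc l₁ , step e e-arc e∉D w₁) , r₂)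
  ...   | inj₂ J = inj₂ (jump-prepend e J)
    where
    jump-prepend : ∀ {x m l} e → Jump (head q e) x m l → Jump (tail q e) x m (suc l)
    jump-prepend e J = record
      { arc = arc ; before = suc before ; after = after ; below = below ; above = above
      ; reach-tail = subst (_≤ tail q arc) (sym (+-suc (tail q e) before))
                       (≤-trans (+-monoˡ-≤ before (tail<head e)) reach-tail)
      ; leave-head = leave-head ; split-length = cong suc split-length }
      where open Jump J

  -- A walk from a to x ≤ b jumping over the midpoint of the dyadic interval
  -- [a , b] consists of the jumping arc alone: by laminarity that arc starts
  -- at a and ends at or beyond b.
  jump-is-single-arc : ∀ {n a b x l} → Dyadic (suc n) a b → x ≤ b → Jump a x (a + 2 ^ n) l → l ≡ 1
  jump-is-single-arc {n} {a} (dyadic k _ _ refl refl) x≤b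
    record { arc = (i , j) ; before = before ; after = after ; below = below ; above = above
           ; reach-tail = reach-tail ; leave-head = leave-head ; split-length = split-length }
    with laminar (q ∸ i) j n k (≤-trans (m≤m+n a before) reach-tail) below above
  ... | tail≡a , b≤head = begin
    _                  ≡⟨ split-length ⟩
    before + suc after ≡⟨ cong₂ (λ m n → m + suc n) (no-room reach-tail (≤-reflexive tail≡a))
                                                  (no-room leave-head (≤-trans x≤b b≤head)) ⟩
    1                  ∎
    where open ≡-Reasoning

  cross-midpoint : ∀ {n a b x l} → Dyadic (suc n) a b → a + 2 ^ n ≤ x → x ≤ b →
                   Walk q D a x l →
                   (Reachable q D a (a + 2 ^ n) × Reachable q D (a + 2 ^ n) x) ⊎ (l ≡ 1)
  cross-midpoint {n} {a} d m≤x x≤b w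
    with visit-or-jump (a + 2 ^ n) (<⇒≤ (proj₁ (midpoint-inside d))) m≤x w
  ... | inj₁ visits = inj₁ visits
  ... | inj₂ J      = inj₂ (jump-is-single-arc d x≤b J)

  Within : ℕ → ℕ → Pred Arc 0ℓ
  Within a b e = (a ≤ tail q e) × (head q e ≤ b)

  within? : ∀ a b → Decidable (Within a b)
  within? a b e = (a ≤? tail q e) ×-dec (head q e ≤? b)

  deleted : ℕ → ℕ → ℕ
  deleted a b = count (within? a b) D

  module Split {a m b} (a≤m : a ≤ m) (m≤b : m ≤ b) =
    DisjointCount (within? a m) (within? m b) (within? a b)
      (λ {e} (_ , head≤m) (m≤tail , _) → <⇒≱ (tail<head e) (≤-trans head≤m m≤tail))
      (λ (a≤tail , head≤m) → a≤tail , ≤-trans head≤m m≤b)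
      (λ (m≤tail , head≤b) → ≤-trans a≤m m≤tail , head≤b)

  deleted-halves : ∀ {n a b} → Dyadic (suc n) a b →
                   deleted a (a + 2 ^ n) + deleted (a + 2 ^ n) b ≤ deleted a b
  deleted-halves d = Split.count-disjoint (<⇒≤ a<m) (<⇒≤ m<b) D
    where a<m = proj₁ (midpoint-inside d) ; m<b = proj₂ (midpoint-inside d)

  -- a deleted spanning arc is counted in [a , b] but in neither half
  deleted-halves-spanning : ∀ {n a b} (d : Dyadic (suc n) a b) → spanning d ∈ D →
                            deleted a (a + 2 ^ n) + deleted (a + 2 ^ n) b < deleted a b
  deleted-halves-spanning {n} {a} d e₀∈D =
    Split.count-disjoint-strict (<⇒≤ a<m) (<⇒≤ m<b)
      (≤-reflexive (sym tail≡a) , ≤-reflexive head≡b)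
      (λ (_ , b≤m) → <⇒≱ m<b (subst (_≤ _) head≡b b≤m))
      (λ (m≤a , _) → <⇒≱ a<m (subst (a + 2 ^ n ≤_) tail≡a m≤a))
      e₀∈D
    where
    a<m = proj₁ (midpoint-inside d) ; m<b = proj₂ (midpoint-inside d)
    tail≡a = proj₁ (proj₂ (spanning-arc d)) ; head≡b = proj₂ (proj₂ (spanning-arc d))

  level-zero-short : ∀ {a b x l} → Dyadic 0 a b → x ≤ b → Walk q D a x l → l ≤ 1
  level-zero-short {a} (dyadic _ _ _ _ refl) x≤b w = +-cancelˡ-≤ a _ 1 (≤-trans (walk-ascends w) x≤b)

  spanning-walk : ∀ {n a b} (d : Dyadic n a b) → spanning d ∉ D → Walk q D a b 1
  spanning-walk d e₀∉D with spanning-arc d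
  ... | e₀-arc , tail≡a , head≡b =
    subst₂ (λ u v → Walk q D u v 1) tail≡a head≡b (step (spanning d) e₀-arc e₀∉D [])

  spanning-bound : ∀ n {a b l} → Dyadic n a b → Walk q D a b l → DistLe q D a b (suc (deleted a b))
  spanning-bound zero d w = walk-dist w (≤-trans (level-zero-short d ≤-refl w) (s≤s z≤n))
  spanning-bound (suc n) {a} {b} d w with spanning d ∈? D
  ... | no e₀∉D = walk-dist (spanning-walk d e₀∉D) (s≤s z≤n)
  ... | yes e₀∈D with cross-midpoint d (<⇒≤ (proj₂ (midpoint-inside d))) ≤-refl w
  ...   | inj₂ refl = walk-dist w (s≤s z≤n)
  ...   | inj₁ ((_ , w₁) , (_ , w₂)) =
    dist-weaken counts
      (dist-concat (spanning-bound n (proj₁ (halves d)) w₁) (spanning-bound n (proj₂ (halves d)) w₂))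
    where
    m = a + 2 ^ n
    counts : suc (deleted a m) + suc (deleted m b) ≤ suc (deleted a b)
    counts = s≤s (subst (_≤ deleted a b) (sym (+-suc (deleted a m) (deleted m b)))
                        (deleted-halves-spanning d e₀∈D))

  vertex-bound : ∀ n {a b x} → Dyadic n a b → x ≤ b → Reachable q D a x →
                 DistLe q D a x (n + deleted a b + 1)
  vertex-bound zero {a} {b} d x≤b (_ , w) =
    walk-dist w (≤-trans (level-zero-short d x≤b w) (m≤n+m 1 (deleted a b)))
  vertex-bound (suc n) {a} {b} {x} d x≤b (l , w) with x ≤? a + 2 ^ n
  ... | yes x≤m = dist-weaken (+-monoˡ-≤ 1 (+-mono-≤ (n≤1+n n) left≤))
                    (vertex-bound n (proj₁ (halves d)) x≤m (l , w))
    where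
    left≤ : deleted a (a + 2 ^ n) ≤ deleted a b
    left≤ = ≤-trans (m≤m+n _ _) (deleted-halves d)
  ... | no x≰m with cross-midpoint d (<⇒≤ (≰⇒> x≰m)) x≤b w
  ...   | inj₂ refl = walk-dist w (m≤n+m 1 (suc n + deleted a b))
  ...   | inj₁ ((_ , w₁) , r₂) =
    dist-weaken counts
      (dist-concat (spanning-bound n (proj₁ (halves d)) w₁) (vertex-bound n (proj₂ (halves d)) x≤b r₂))
    where
    m = a + 2 ^ n
    counts : suc (deleted a m) + (n + deleted m b + 1) ≤ suc n + deleted a b + 1
    counts = subst (_≤ suc n + deleted a b + 1) (sym (regroup n (deleted a m) (deleted m b)))
                   (+-monoˡ-≤ 1 (+-monoʳ-≤ (suc n) (deleted-halves d)))

-- The theorem is (B) for the whole fractal, the dyadic interval [σ , τ] of level q;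
-- at most length D of the deleted arcs lie inside it.
lemma11 : (q : ℕ) (D : List Arc) → All (IsArc q) D → Unique D →
          (x : ℕ) → IsVertex q x → Reachable q D σ x →
          DistLe q D σ x (q + length D + 1)
lemma11 q D _ _ x x≤τ reachable =
  dist-weaken (+-monoˡ-≤ 1 (+-monoʳ-≤ q (length-filter (within? σ (τ q)) D)))
              (vertex-bound q whole x≤τ reachable)
  where
  open DyadicIntervals q
  open Walks q D
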